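{- Let $f$ be a polymorphism of $(\mathbf{LO}_2,\mathbf{LO}_3)$ of arity $n\ge 7$ with no small 2-sets, and suppose that $f$ has a unique pure saturation $g$. Let $t$ be the dictating variable of $g$ (i.e. $g$ is a recoloured projection with dictating variable $t$), and let $X\subseteq[n]$ satisfy $t\in X$ and $f(X)=1$. Then $X\cap Y\ne\emptyset$ for every $Y\subseteq[n]$ with $f(Y)=1$ and $Y\cap T_g\ne\emptyset$.
   Context: $[n]=\{1,\dots,n\}$; $[t\in S]$ is the Iverson bracket. $\mathrm{LO}_3\subseteq\{0,1,2\}^3$ is the set of triples whose maximum entry occurs in exactly one coordinate. Identify $X\subseteq[n]$ with the 0/1 tuple having 1 exactly in positions of $X$. $f:\{0,1\}^n\to\{0,1,2\}$ is a polymorphism of $(\mathbf{LO}_2,\mathbf{LO}_3)$ iff for every ordered partition $(X,Y,Z)$ of $[n]$ into three (possibly empty) parts, $(f(X),f(Y),f(Z))\in\mathrm{LO}_3$. $X$ is an $i$-set if $f(X)=i$, a boolean set if $f(X)\in\{0,1\}$; a small 2-set is a 2-set with at most three elements. For $i\ne f(X)$, $X$ is $i$-recolourable if changing $f$'s value at $X$ alone to $i$ still yields a polymorphism; a boolean $i$-set ($i\in\{0,1\}$) is static if not $(1-i)$-recolourable. $f$ is saturated if every superset of a 2-set is a 2-set and for every $X$, $X$ or $[n]\setminus X$ is a 2-set. A saturated $n$-ary polymorphism $g$ is a saturation of $f$ if there is a sequence $f=f_1,\dots,f_l=g$ of $n$-ary polymorphisms where each $f_i$ is obtained from $f_{i-1}$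 by changing the value at a single boolean set to 2; pure if $g$ has no small 2-sets. $g$ is a recoloured projection with dictating variable $t$ if $g(S)=[t\in S]$ for every static boolean set $S$ of $g$. $T_g$ is the union of all inclusion-minimal 2-sets of $g$. -}

module Defs where

open import Data.Nat using (ℕ; zero; suc; _<_; _≤_)
open import Data.Fin using (Fin; toℕ)
import Data.Fin as Fin
open import Data.Fin.Subset using (Subset; _∈_; _⊆_; ∁; ∣_∣; inside)
open import Data.Bool using (Bool; true; false; if_then_else_)
import Data.Bool.Properties as BoolP
open import Data.Vec using (lookup)
open import Data.Vec.Properties using (≡-dec)
open import Data.Product using (Σ; ∃; _×_; _,_)
open import Data.Sum using (_⊎_)
open import Relation.Nullary using (¬_; Dec; yes; no)
open import Relation.Binary.PropositionalEquality using (_≡_; _≢_)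

Col : Set
Col = Fin 3

c0 c1 c2 : Col
c0 = Fin.zero
c1 = Fin.suc Fin.zero
c2 = Fin.suc (Fin.suc Fin.zero)

LO3 : Col → Col → Col → Set
LO3 a b c =
  (toℕ b < toℕ a × toℕ c < toℕ a) ⊎
  ((toℕ a < toℕ b × toℕ c < toℕ b) ⊎
   (toℕ a < toℕ c × toℕ b < toℕ c))

IsPartition : ∀ {n} → Subset n → Subset n → Subset n → Set
IsPartition {n} X Y Z =
  (∀ (i : Fin n) → i ∈ X ⊎ (i ∈ Y ⊎ i ∈ Z)) ×
  ((∀ (i : Fin n) → i ∈ X → ¬ (i ∈ Y)) ×
   ((∀ (i : Fin n) → i ∈ X → ¬ (i ∈ Z)) ×
    (∀ (i : Fin n) → i ∈ Y → ¬ (i ∈ Z))))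

-- n-ary functions {0,1}^n → {0,1,2}
Fun : ℕ → Set
Fun n = Subset n → Col

IsPolymorphism : ∀ {n} → Fun n → Set
IsPolymorphism {n} f =
  ∀ (X Y Z : Subset n) → IsPartition X Y Z → LO3 (f X) (f Y) (f Z)

update : ∀ {n} → Fun n → Subset n → Col → Fun n
update f X i S with ≡-dec BoolP._≟_ S X
... | yes _ = i
... | no _  = f S

Recolourable : ∀ {n} → Fun n → Subset n → Col → Set
Recolourable f X i = (i ≢ f X) × IsPolymorphism (update f X i)

Static : ∀ {n} → Fun n → Subset n → Set
Static f X =
  (f X ≡ c0 × ¬ Recolourable f X c1) ⊎ (f X ≡ c1 × ¬ Recolourable f X c0)

NoSmall2Sets : ∀ {n} → Fun n → Set
NoSmall2Sets {n} f = ∀ (X : Subset n) → f X ≡ c2 → ¬ (∣ X ∣ ≤ 3)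

IsSaturated : ∀ {n} → Fun n → Set
IsSaturated {n} f =
  (∀ (X Y : Subset n) → f X ≡ c2 → X ⊆ Y → f Y ≡ c2) ×
  (∀ (X : Subset n) → f X ≡ c2 ⊎ f (∁ X) ≡ c2)

SatStep : ∀ {n} → Fun n → Fun n → Set
SatStep {n} f h =
  IsPolymorphism h ×
  Σ (Subset n) (λ X → (f X ≢ c2) × (∀ (S : Subset n) → h S ≡ update f X c2 S))

data SatChain {n : ℕ} : Fun n → Fun n → Set where
  done : ∀ {f g : Fun n} → (∀ (S : Subset n) → f S ≡ g S) → SatChain f g
  step : ∀ {f h g : Fun n} → SatStep f h → SatChain h g → SatChain f g

IsSaturation : ∀ {n} → Fun n → Fun n → Set
IsSaturation f g = IsPolymorphism g × (IsSaturated g × SatChain f g)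

IsPureSaturation : ∀ {n} → Fun n → Fun n → Set
IsPureSaturation f g = IsSaturation f g × NoSmall2Sets g

UniquePureSaturation : ∀ {n} → Fun n → Fun n → Set
UniquePureSaturation {n} f g =
  IsPureSaturation f g ×
  (∀ (g' : Fun n) → IsPureSaturation f g' → ∀ (S : Subset n) → g' S ≡ g S)

iverson : ∀ {n} → Fin n → Subset n → Col
iverson t S = if lookup S t then c1 else c0

RecolouredProjection : ∀ {n} → Fun n → Fin n → Set
RecolouredProjection {n} g t =
  ∀ (S : Subset n) → Static g S → g S ≡ iverson t S

Minimal2Set : ∀ {n} → Fun n → Subset n → Set
Minimal2Set {n} g M =
  g M ≡ c2 × (∀ (M' : Subset n) → M' ⊆ M → g M' ≡ c2 → M' ≡ M)

-- i ∈ T_g : union of all inclusion-minimal 2-sets of g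
InT : ∀ {n} → Fun n → Fin n → Set
InT {n} g i = Σ (Subset n) (λ M → Minimal2Set g M × i ∈ M)

-- If X and Y were disjoint 1-sets of f, the rest Z of [n] would be a 2-set of f, hence of g,
-- and Y would stay a 1-set of g. A 1-set Y of g meeting a minimal 2-set M is static: the
-- partition (Y, M ∖ Y, rest) has colours (1, 0, 0), since M ∖ Y ⊊ M and the rest is disjoint
-- from the 2-set M, so recolouring Y to 0 would produce (0, 0, 0). Hence g Y = [t ∈ Y] = 0.
module Submission where

open import Defs
open import Data.Nat using (ℕ; _≤_; _<?_)
open import Data.Fin using (Fin; zero; suc; toℕ)
open import Data.Fin.Subset using (Subset; _∈_; _∉_; _∩_; _∪_; ∁)
open import Data.Fin.Subset.Properties
  using (_∈?_; x∈p∩q⁺; x∈p∩q⁻; x∈p∪q⁻; x∈p∪q⁺; x∉p⇒x∈∁p; x∈∁p⇒x∉p; p∩q⊆p)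
open import Data.Fin.Properties using (any?)
open import Data.Product using (Σ; _×_; _,_; proj₁; proj₂)
open import Data.Sum using (_⊎_; inj₁; inj₂; [_,_])
open import Data.Empty using (⊥-elim)
open import Function using (_∘_)
open import Data.Bool using (true; false)
import Data.Bool.Properties as BoolP
open import Data.Vec using (lookup)
open import Data.Vec.Properties using (≡-dec; lookup⇒[]=)
open import Relation.Nullary using (¬_; Dec; yes; no)
open import Relation.Nullary.Decidable using (_×-dec_; _⊎-dec_; False; toWitnessFalse)
open import Relation.Binary.PropositionalEquality
  using (_≡_; _≢_; refl; sym; trans; subst; module ≡-Reasoning)

LO3? : ∀ a b c → Dec (LO3 a b c)
LO3? a b c =
  (toℕ b <? toℕ a ×-dec toℕ c <? toℕ a) ⊎-dec
  ((toℕ a <? toℕ b ×-dec toℕ c <? toℕ b) ⊎-dec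
   (toℕ a <? toℕ c ×-dec toℕ b <? toℕ c))

refuteLO3 : ∀ {a b c} → False (LO3? a b c) → ¬ LO3 a b c
refuteLO3 = toWitnessFalse

LO3-rotate : ∀ {a b c} → LO3 a b c → LO3 b c a
LO3-rotate (inj₁ max-a)              = inj₂ (inj₂ max-a)
LO3-rotate (inj₂ (inj₁ (a<b , c<b))) = inj₁ (c<b , a<b)
LO3-rotate (inj₂ (inj₂ (a<c , b<c))) = inj₂ (inj₁ (b<c , a<c))

¬LO3-·22 : ∀ {a b c} → b ≡ c2 → c ≡ c2 → ¬ LO3 a b c
¬LO3-·22 {zero}           refl refl = refuteLO3 _
¬LO3-·22 {suc zero}       refl refl = refuteLO3 _
¬LO3-·22 {suc (suc zero)} refl refl = refuteLO3 _

¬LO3-22· : ∀ {a b c} → a ≡ c2 → b ≡ c2 → ¬ LO3 a b c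
¬LO3-22· a≡2 b≡2 = ¬LO3-·22 a≡2 b≡2 ∘ LO3-rotate ∘ LO3-rotate

¬LO3-000 : ∀ {a b c} → a ≡ c0 → b ≡ c0 → c ≡ c0 → ¬ LO3 a b c
¬LO3-000 refl refl refl = refuteLO3 _

LO3-11·⇒2 : ∀ {a b c} → a ≡ c1 → b ≡ c1 → LO3 a b c → c ≡ c2
LO3-11·⇒2 {c = zero}           refl refl = ⊥-elim ∘ refuteLO3 _
LO3-11·⇒2 {c = suc zero}       refl refl = ⊥-elim ∘ refuteLO3 _
LO3-11·⇒2 {c = suc (suc zero)} refl refl _ = refl

LO3-1··⇒00 : ∀ {a b c} → a ≡ c1 → b ≢ c2 → c ≢ c2 → LO3 a b c → b ≡ c0 × c ≡ c0
LO3-1··⇒00 {b = zero}           {c = zero}     refl _   _   _  = refl , refl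
LO3-1··⇒00 {b = zero}           {c = suc zero} refl _   _   lo = ⊥-elim (refuteLO3 _ lo)
LO3-1··⇒00 {b = suc zero}       {c = zero}     refl _   _   lo = ⊥-elim (refuteLO3 _ lo)
LO3-1··⇒00 {b = suc zero}       {c = suc zero} refl _   _   lo = ⊥-elim (refuteLO3 _ lo)
LO3-1··⇒00 {b = suc (suc zero)}                _    b≢2 _   _  = ⊥-elim (b≢2 refl)
LO3-1··⇒00 {c = suc (suc zero)}                _    _   c≢2 _  = ⊥-elim (c≢2 refl)

update-≡ : ∀ {n} (f : Fun n) X i → update f X i X ≡ i
update-≡ f X i with ≡-dec BoolP._≟_ X X
... | yes _  = refl
... | no X≢X = ⊥-elim (X≢X refl)

update-≢ : ∀ {n} (f : Fun n) X i {S} → S ≢ X → update f X i S ≡ f S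
update-≢ f X i {S} S≢X with ≡-dec BoolP._≟_ S X
... | yes S≡X = ⊥-elim (S≢X S≡X)
... | no _    = refl

satChain-2-or-unchanged : ∀ {n} {f g : Fun n} → SatChain f g → ∀ S → g S ≡ c2 ⊎ g S ≡ f S
satChain-2-or-unchanged (done f≗g) S = inj₂ (sym (f≗g S))
satChain-2-or-unchanged {f = f} (step (_ , X , _ , h≗f[X↦2]) rest) S
  with satChain-2-or-unchanged rest S | ≡-dec BoolP._≟_ S X
... | inj₁ gS≡2  | _        = inj₁ gS≡2
... | inj₂ gS≡hS | yes refl = inj₁ (trans gS≡hS (trans (h≗f[X↦2] S) (update-≡ f S c2)))
... | inj₂ gS≡hS | no S≢X   = inj₂ (trans gS≡hS (trans (h≗f[X↦2] S) (update-≢ f X c2 S≢X)))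

satChain-preserves-2 : ∀ {n} {f g : Fun n} → SatChain f g → ∀ {S} → f S ≡ c2 → g S ≡ c2
satChain-preserves-2 chain {S} fS≡2 with satChain-2-or-unchanged chain S
... | inj₁ gS≡2  = gS≡2
... | inj₂ gS≡fS = trans gS≡fS fS≡2

Disjoint : ∀ {n} → Subset n → Subset n → Set
Disjoint {n} X Y = ∀ (i : Fin n) → i ∈ X → i ∉ Y

disjoint⇒partition : ∀ {n} {X Y : Subset n} → Disjoint X Y → IsPartition X Y (∁ (X ∪ Y))
disjoint⇒partition {X = X} {Y} X∩Y≡∅ =
  cover , X∩Y≡∅ ,
  (λ i i∈X i∈Z → x∈∁p⇒x∉p i∈Z (x∈p∪q⁺ (inj₁ i∈X))) ,
  (λ i i∈Y i∈Z → x∈∁p⇒x∉p i∈Z (x∈p∪q⁺ (inj₂ i∈Y)))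
  where
  cover : ∀ i → i ∈ X ⊎ (i ∈ Y ⊎ i ∈ ∁ (X ∪ Y))
  cover i with i ∈? X | i ∈? Y
  ... | yes i∈X | _       = inj₁ i∈X
  ... | no _    | yes i∈Y = inj₂ (inj₁ i∈Y)
  ... | no i∉X  | no i∉Y  = inj₂ (inj₂ (x∉p⇒x∈∁p ([ i∉X , i∉Y ] ∘ x∈p∪q⁻ X Y)))

disjoint-1-sets⇒2-set : ∀ {n} {f : Fun n} {X Y} → IsPolymorphism f → Disjoint X Y →
  f X ≡ c1 → f Y ≡ c1 → f (∁ (X ∪ Y)) ≡ c2
disjoint-1-sets⇒2-set {X = X} {Y} f-poly X∩Y≡∅ fX≡1 fY≡1 =
  LO3-11·⇒2 fX≡1 fY≡1 (f-poly X Y (∁ (X ∪ Y)) (disjoint⇒partition X∩Y≡∅))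

disjoint-1-sets-survive-saturation : ∀ {n} {f g : Fun n} {X Y} →
  IsPolymorphism f → IsPolymorphism g → SatChain f g →
  Disjoint X Y → f X ≡ c1 → f Y ≡ c1 → g Y ≡ c1
disjoint-1-sets-survive-saturation {g = g} {X} {Y} f-poly g-poly chain X∩Y≡∅ fX≡1 fY≡1
  with satChain-2-or-unchanged chain Y
... | inj₂ gY≡fY = trans gY≡fY fY≡1
... | inj₁ gY≡2  = ⊥-elim (¬LO3-·22 gY≡2 gZ≡2 (g-poly X Y _ (disjoint⇒partition X∩Y≡∅)))
  where
  gZ≡2 : g (∁ (X ∪ Y)) ≡ c2
  gZ≡2 = satChain-preserves-2 chain (disjoint-1-sets⇒2-set f-poly X∩Y≡∅ fX≡1 fY≡1)

1-set-meeting-minimal-2-set⇒static : ∀ {n} {g : Fun n} {M Y : Subset n} {i} →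
  IsPolymorphism g → Minimal2Set g M → i ∈ M → i ∈ Y → g Y ≡ c1 → Static g Y
1-set-meeting-minimal-2-set⇒static {g = g} {M} {Y} {i} g-poly (gM≡2 , M-minimal) i∈M i∈Y gY≡1 =
  inj₂ (gY≡1 , λ (_ , h-poly) →
    ¬LO3-000 (update-≡ g Y c0)
             (trans (recolouring-fixes i∉D) (proj₁ gD≡0×gR≡0))
             (trans (recolouring-fixes i∉R) (proj₂ gD≡0×gR≡0))
             (h-poly Y D R YDR))
  where
  D R : Subset _
  D = M ∩ ∁ Y
  R = ∁ (Y ∪ D)

  Y∩D≡∅ : Disjoint Y D
  Y∩D≡∅ j j∈Y j∈D = x∈∁p⇒x∉p (proj₂ (x∈p∩q⁻ M (∁ Y) j∈D)) j∈Y

  YDR : IsPartition Y D R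
  YDR = disjoint⇒partition Y∩D≡∅

  M∩R≡∅ : Disjoint M R
  M∩R≡∅ j j∈M j∈R with j ∈? Y
  ... | yes j∈Y = x∈∁p⇒x∉p j∈R (x∈p∪q⁺ (inj₁ j∈Y))
  ... | no j∉Y  = x∈∁p⇒x∉p j∈R (x∈p∪q⁺ (inj₂ (x∈p∩q⁺ (j∈M , x∉p⇒x∈∁p j∉Y))))

  i∉D : i ∉ D
  i∉D = Y∩D≡∅ i i∈Y

  i∉R : i ∉ R
  i∉R i∈R = x∈∁p⇒x∉p i∈R (x∈p∪q⁺ (inj₁ i∈Y))

  gD≢2 : g D ≢ c2
  gD≢2 gD≡2 = i∉D (subst (i ∈_) (sym (M-minimal D (p∩q⊆p M (∁ Y)) gD≡2)) i∈M)

  gR≢2 : g R ≢ c2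
  gR≢2 gR≡2 = ¬LO3-22· gM≡2 gR≡2 (g-poly M R _ (disjoint⇒partition M∩R≡∅))

  gD≡0×gR≡0 : g D ≡ c0 × g R ≡ c0
  gD≡0×gR≡0 = LO3-1··⇒00 gY≡1 gD≢2 gR≢2 (g-poly Y D R YDR)

  recolouring-fixes : ∀ {S} → i ∉ S → update g Y c0 S ≡ g S
  recolouring-fixes i∉S = update-≢ g Y c0 (λ S≡Y → i∉S (subst (i ∈_) (sym S≡Y) i∈Y))

iverson-∉ : ∀ {n} {t : Fin n} {S} → t ∉ S → iverson t S ≡ c0
iverson-∉ {t = t} {S} t∉S with lookup S t in S[t]
... | true  = ⊥-elim (t∉S (lookup⇒[]= t S S[t]))
... | false = refl

mainTheorem12 : (n : ℕ) → 7 ≤ n → (f g : Fun n) → (t : Fin n) →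
    IsPolymorphism f → NoSmall2Sets f →
    UniquePureSaturation f g → RecolouredProjection g t →
    (X : Subset n) → t ∈ X → f X ≡ c1 →
    (Y : Subset n) → f Y ≡ c1 → Σ (Fin n) (λ i → i ∈ Y × InT g i) →
    Σ (Fin n) (λ j → j ∈ X × j ∈ Y)
mainTheorem12 n _ f g t f-poly _ (((g-poly , _ , chain) , _) , _) dictated
              X t∈X fX≡1 Y fY≡1 (i , i∈Y , M , M-minimal , i∈M)
  with any? (λ j → j ∈? X ×-dec j ∈? Y)
... | yes common = common
... | no ¬common = ⊥-elim (c1≢c0 (begin
      c1           ≡⟨ sym gY≡1 ⟩
      g Y          ≡⟨ dictated Y (1-set-meeting-minimal-2-set⇒static g-poly M-minimal i∈M i∈Y gY≡1) ⟩
      iverson t Y  ≡⟨ iverson-∉ (X∩Y≡∅ t t∈X) ⟩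
      c0           ∎))
  where
  open ≡-Reasoning

  X∩Y≡∅ : Disjoint X Y
  X∩Y≡∅ j j∈X j∈Y = ¬common (j , j∈X , j∈Y)

  gY≡1 : g Y ≡ c1
  gY≡1 = disjoint-1-sets-survive-saturation f-poly g-poly chain X∩Y≡∅ fX≡1 fY≡1

  c1≢c0 : c1 ≢ c0
  c1≢c0 ()
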